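{- Let $k\ge1$, let $\delta=1$ if $k$ is odd and $\delta=2$ if $k$ is even, and fix an integer $\ell\ge0$. Let $U(x)=\frac{x}{1-x}$ and $S(x)=\frac{x}{1-x}-\frac{x^{k+\delta}}{1-x^2}=\frac{x(1+x)-x^{k+\delta}}{(1-x)(1+x)}$. Then \[ \sum_{n\ge0}L_{k,\ell}(n)x^n=S(x)^\ell\cdot\frac{1}{1-U(x)}=S(x)^\ell\cdot\frac{1-x}{1-2x}=\frac{\big(x(1+x)-x^{k+\delta}\big)^\ell}{(1-2x)(1-x)^{\ell-1}(1+x)^\ell}. \]
   Context: A composition of a nonnegative integer $n$ is a finite sequence $(m_1,\dots,m_r)$ of positive integers with $m_1+\cdots+m_r=n$ (for $n=0$, only the empty composition). Let $\mathrm{Ev}_{>k}=\{j\in\mathbb{Z}_{\ge1}: j \text{ even and } j>k\}$. For $\ell\ge0$, $L_{k,\ell}(n)$ is the number of compositions $(m_1,\dots,m_r)$ of $n$ with $r\ge\ell$ such that $m_1,\dots,m_\ell\notin\mathrm{Ev}_{>k}$ (for $\ell=0$ the condition is vacuous, so $L_{k,0}(n)$ is the number of all compositions of $n$). -}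

module Defs where

open import Data.Nat as ℕ using (ℕ; zero; suc; _∸_; _<ᵇ_; _≡ᵇ_; _%_; _≤ᵇ_)
open import Data.Bool using (Bool; true; false; _∧_; not; if_then_else_)
open import Data.List using (List; []; _∷_; [_]; map; concatMap; upTo; length; take; filterᵇ; _++_; sum; foldr)
open import Data.Integer as ℤ using (ℤ; +_; -_) renaming (_+_ to _+ℤ_; _*_ to _*ℤ_; _-_ to _-ℤ_)

-- compsF f n : all compositions of n (fuel f ≥ n suffices); the first part
-- is suc m for m = 0..n-1, followed by a composition of the rest.
compsF : ℕ → ℕ → List (List ℕ)
compsF _ zero = [ [] ]
compsF zero (suc n) = []
compsF (suc f) (suc n) =
  concatMap (λ m → map (suc m ∷_) (compsF f (n ∸ m))) (upTo (suc n))

compositions : ℕ → List (List ℕ)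
compositions n = compsF n n

inEv>  : ℕ → ℕ → Bool
inEv> k j = ((j % 2) ≡ᵇ 0) ∧ (k <ᵇ j)

allᵇ : {A : Set} → (A → Bool) → List A → Bool
allᵇ p [] = true
allᵇ p (x ∷ xs) = p x ∧ allᵇ p xs

good : ℕ → ℕ → List ℕ → Bool
good k ℓ c = (ℓ ≤ᵇ length c) ∧ allᵇ (λ j → not (inEv> k j)) (take ℓ c)

L : ℕ → ℕ → ℕ → ℕ
L k ℓ n = length (filterᵇ (good k ℓ) (compositions n))

Series : Set
Series = ℕ → ℤ

const : ℤ → Series
const c zero = c
const c (suc _) = + 0

X : Series
X 1 = + 1
X _ = + 0

_⊕_ : Series → Series → Series
(f ⊕ g) n = f n +ℤ g n

_⊖_ : Series → Series → Series
(f ⊖ g) n = f n -ℤ g n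

_⊛_ : Series → Series → Series
(f ⊛ g) n = foldr _+ℤ_ (+ 0) (map (λ i → f i *ℤ g (n ∸ i)) (upTo (suc n)))

infixl 6 _⊕_ _⊖_
infixl 7 _⊛_

_^ₛ_ : Series → ℕ → Series
f ^ₛ zero = const (+ 1)
f ^ₛ suc m = f ⊛ (f ^ₛ m)

infixr 8 _^ₛ_

nth : List ℤ → ℕ → ℤ
nth [] _ = + 0
nth (x ∷ xs) zero = x
nth (x ∷ xs) (suc i) = nth xs i

-- Multiplicative inverse of a series f with constant term 1 (only used for such f):
-- b_0 = 1, b_n = - Σ_{i=1}^{n} f_i b_{n-i}.  invL f n = [b_0, …, b_n].
invL : Series → ℕ → List ℤ
invL f zero = [ + 1 ]
invL f (suc n) =
  let prev = invL f n in
  prev ++ [ - foldr _+ℤ_ (+ 0)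
              (map (λ i → f (suc i) *ℤ nth prev (n ∸ i)) (upTo (suc n))) ]

inv : Series → Series
inv f n = nth (invL f n) n

one : Series
one = const (+ 1)

δ : ℕ → ℕ
δ k = if (k % 2) ≡ᵇ 1 then 1 else 2

U : Series
U = X ⊛ inv (one ⊖ X)

S : ℕ → Series
S k = X ⊛ inv (one ⊖ X) ⊖ X ^ₛ (k ℕ.+ δ k) ⊛ inv (one ⊖ X ^ₛ 2)

Lgf : ℕ → ℕ → Series
Lgf k ℓ n = + L k ℓ n

-- (1-x)^{-(ℓ-1)} : equals (1-x) when ℓ = 0, and 1/(1-x)^{ℓ-1} when ℓ ≥ 1
invOneMinusXPowPred : ℕ → Series
invOneMinusXPowPred zero = one ⊖ X
invOneMinusXPowPred (suc m) = inv ((one ⊖ X) ^ₛ m)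

finalForm : ℕ → ℕ → Series
finalForm k ℓ =
  (X ⊛ (one ⊕ X) ⊖ X ^ₛ (k ℕ.+ δ k)) ^ₛ ℓ
    ⊛ inv (one ⊖ const (+ 2) ⊛ X)
    ⊛ invOneMinusXPowPred ℓ
    ⊛ inv ((one ⊕ X) ^ₛ ℓ)

_≈ₛ_ : Series → Series → Set
f ≈ₛ g = ∀ n → f n ≡ g n
  where open import Relation.Binary.PropositionalEquality using (_≡_)

-- Sorting compositions by their first part shows that the generating series
-- L_ℓ of L_{k,ℓ} satisfy L_{ℓ+1} = A · L_ℓ and L_0 = 1 + U · L_0, where
-- A = Σ_{j ≥ 1, j ∉ Ev_{>k}} x^j and U = Σ_{j ≥ 1} x^j.  Reading off coefficients
-- gives A = S: x/(1-x) has all positive coefficients 1, and x^{k+δ}/(1-x²) is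
-- the indicator series of Ev_{>k} because k+δ is the least even number above k.
-- What remains is computation in the ring of power series, with
-- (1-U)(1-x) = 1-2x and S(1-x)(1+x) = x(1+x) - x^{k+δ}.

module Submission where

open import Defs
open import Algebra.Bundles using (CommutativeMonoid)
import Algebra.Solver.CommutativeMonoid as CommutativeMonoidSolver
open import Data.Bool using (Bool; true; false; _∧_; not; if_then_else_; T?)
open import Data.Bool.Properties using (∧-zeroʳ; ∧-identityʳ)
open import Data.Integer using (ℤ; +_; -_; -1ℤ) renaming (_+_ to _+ℤ_; _*_ to _*ℤ_; _-_ to _-ℤ_)
import Data.Integer.Properties as ℤ
open import Data.Integer.Tactic.RingSolver using (solve-∀)
open import Data.List using (List; []; _∷_; [_]; map; foldr; upTo; concat; length; filterᵇ; _++_)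
open import Data.List.Properties using (map-applyUpTo; map-upTo; map-cong; map-∘; length-++; filter-++)
open import Data.Nat using (ℕ; zero; suc; _+_; _∸_; _≤_; _<_; s≤s; _<ᵇ_; _≤ᵇ_; _%_; _≡ᵇ_)
import Data.Nat.Properties as ℕ
open import Data.Product using (_×_; _,_)
open import Data.Sum using (inj₁; inj₂)
open import Function using (_∘_)
open import Relation.Binary.Bundles using (Setoid)
open import Relation.Binary.PropositionalEquality hiding ([_]; J)
import Relation.Binary.Reasoning.Setoid as SetoidReasoning

tail : Series → Series
tail f n = f (suc n)

_·ₛ_ : ℤ → Series → Series
(c ·ₛ f) n = c *ℤ f n

infixr 7 _·ₛ_

⊛-zero : ∀ f g → (f ⊛ g) 0 ≡ f 0 *ℤ g 0
⊛-zero f g = ℤ.+-identityʳ (f 0 *ℤ g 0)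

tail-⊛ : ∀ f g → tail (f ⊛ g) ≈ₛ (f 0 ·ₛ tail g ⊕ tail f ⊛ g)
tail-⊛ f g n = cong (λ xs → f 0 *ℤ g (suc n) +ℤ foldr _+ℤ_ (+ 0) xs)
  (trans (map-applyUpTo suc summand (suc n)) (sym (map-upTo (summand ∘ suc) (suc n))))
  where
  summand : ℕ → ℤ
  summand i = f i *ℤ g (suc n ∸ i)

⊛-cong : ∀ {f f′ g g′} → f ≈ₛ f′ → g ≈ₛ g′ → (f ⊛ g) ≈ₛ (f′ ⊛ g′)
⊛-cong f≈f′ g≈g′ n =
  cong (foldr _+ℤ_ (+ 0)) (map-cong (λ i → cong₂ _*ℤ_ (f≈f′ i) (g≈g′ (n ∸ i))) (upTo (suc n)))

⊛-congˡ : ∀ {f f′} g → f ≈ₛ f′ → (f ⊛ g) ≈ₛ (f′ ⊛ g)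
⊛-congˡ {f} {f′} g f≈f′ = ⊛-cong {f} {f′} {g} {g} f≈f′ (λ _ → refl)

⊛-congʳ : ∀ f {g g′} → g ≈ₛ g′ → (f ⊛ g) ≈ₛ (f ⊛ g′)
⊛-congʳ f {g} {g′} g≈g′ = ⊛-cong {f} {f} {g} {g′} (λ _ → refl) g≈g′

⊖-cong : ∀ {f f′ g g′} → f ≈ₛ f′ → g ≈ₛ g′ → (f ⊖ g) ≈ₛ (f′ ⊖ g′)
⊖-cong f≈f′ g≈g′ n = cong₂ _-ℤ_ (f≈f′ n) (g≈g′ n)

⊛-zeroˡ : ∀ f → ((λ _ → + 0) ⊛ f) ≈ₛ (λ _ → + 0)
⊛-zeroˡ f zero = refl
⊛-zeroˡ f (suc n) = trans (tail-⊛ (λ _ → + 0) f n) (cong (+ 0 +ℤ_) (⊛-zeroˡ f n))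

const-⊛ : ∀ c f → (const c ⊛ f) ≈ₛ (c ·ₛ f)
const-⊛ c f zero = ⊛-zero (const c) f
const-⊛ c f (suc n) =
  trans (tail-⊛ (const c) f n) (trans (cong (c *ℤ f (suc n) +ℤ_) (⊛-zeroˡ f n)) (ℤ.+-identityʳ _))

⊛-identityˡ : ∀ f → (one ⊛ f) ≈ₛ f
⊛-identityˡ f n = trans (const-⊛ (+ 1) f n) (ℤ.*-identityˡ (f n))

⊛-scaleˡ : ∀ c f g → ((c ·ₛ f) ⊛ g) ≈ₛ (c ·ₛ (f ⊛ g))
⊛-scaleˡ c f g zero = trans (⊛-zero (c ·ₛ f) g) (trans (ℤ.*-assoc c (f 0) (g 0)) (cong (c *ℤ_) (sym (⊛-zero f g))))
⊛-scaleˡ c f g (suc n) = begin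
  ((c ·ₛ f) ⊛ g) (suc n)                       ≡⟨ tail-⊛ (c ·ₛ f) g n ⟩
  c *ℤ f 0 *ℤ g (suc n) +ℤ ((c ·ₛ tail f) ⊛ g) n ≡⟨ cong (c *ℤ f 0 *ℤ g (suc n) +ℤ_) (⊛-scaleˡ c (tail f) g n) ⟩
  c *ℤ f 0 *ℤ g (suc n) +ℤ c *ℤ (tail f ⊛ g) n   ≡⟨ factor c (f 0) (g (suc n)) _ ⟩
  c *ℤ (f 0 *ℤ g (suc n) +ℤ (tail f ⊛ g) n)      ≡⟨ cong (c *ℤ_) (tail-⊛ f g n) ⟨
  (c ·ₛ (f ⊛ g)) (suc n)                       ∎
  where
  open ≡-Reasoning
  factor : ∀ c a b x → c *ℤ a *ℤ b +ℤ c *ℤ x ≡ c *ℤ (a *ℤ b +ℤ x)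
  factor = solve-∀

⊛-distribʳ-⊕ : ∀ f g h → ((f ⊕ g) ⊛ h) ≈ₛ (f ⊛ h ⊕ g ⊛ h)
⊛-distribʳ-⊕ f g h zero = trans (⊛-zero (f ⊕ g) h)
  (trans (ℤ.*-distribʳ-+ (h 0) (f 0) (g 0)) (sym (cong₂ _+ℤ_ (⊛-zero f h) (⊛-zero g h))))
⊛-distribʳ-⊕ f g h (suc n) = begin
  ((f ⊕ g) ⊛ h) (suc n)                                                  ≡⟨ tail-⊛ (f ⊕ g) h n ⟩
  (f 0 +ℤ g 0) *ℤ h (suc n) +ℤ ((tail f ⊕ tail g) ⊛ h) n                  ≡⟨ cong ((f 0 +ℤ g 0) *ℤ h (suc n) +ℤ_) (⊛-distribʳ-⊕ (tail f) (tail g) h n) ⟩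
  (f 0 +ℤ g 0) *ℤ h (suc n) +ℤ ((tail f ⊛ h) n +ℤ (tail g ⊛ h) n)         ≡⟨ regroup (f 0) (g 0) (h (suc n)) _ _ ⟩
  (f 0 *ℤ h (suc n) +ℤ (tail f ⊛ h) n) +ℤ (g 0 *ℤ h (suc n) +ℤ (tail g ⊛ h) n) ≡⟨ cong₂ _+ℤ_ (tail-⊛ f h n) (tail-⊛ g h n) ⟨
  (f ⊛ h ⊕ g ⊛ h) (suc n)                                                ∎
  where
  open ≡-Reasoning
  regroup : ∀ a b c x y → (a +ℤ b) *ℤ c +ℤ (x +ℤ y) ≡ (a *ℤ c +ℤ x) +ℤ (b *ℤ c +ℤ y)
  regroup = solve-∀

⊛-distribʳ-⊖ : ∀ f g h → ((f ⊖ g) ⊛ h) ≈ₛ (f ⊛ h ⊖ g ⊛ h)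
⊛-distribʳ-⊖ f g h zero = trans (⊛-zero (f ⊖ g) h)
  (trans (distrib (f 0) (g 0) (h 0)) (sym (cong₂ _-ℤ_ (⊛-zero f h) (⊛-zero g h))))
  where
  distrib : ∀ a b c → (a -ℤ b) *ℤ c ≡ a *ℤ c -ℤ b *ℤ c
  distrib = solve-∀
⊛-distribʳ-⊖ f g h (suc n) = begin
  ((f ⊖ g) ⊛ h) (suc n)                                                  ≡⟨ tail-⊛ (f ⊖ g) h n ⟩
  (f 0 -ℤ g 0) *ℤ h (suc n) +ℤ ((tail f ⊖ tail g) ⊛ h) n                  ≡⟨ cong ((f 0 -ℤ g 0) *ℤ h (suc n) +ℤ_) (⊛-distribʳ-⊖ (tail f) (tail g) h n) ⟩
  (f 0 -ℤ g 0) *ℤ h (suc n) +ℤ ((tail f ⊛ h) n -ℤ (tail g ⊛ h) n)         ≡⟨ regroup (f 0) (g 0) (h (suc n)) _ _ ⟩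
  (f 0 *ℤ h (suc n) +ℤ (tail f ⊛ h) n) -ℤ (g 0 *ℤ h (suc n) +ℤ (tail g ⊛ h) n) ≡⟨ cong₂ _-ℤ_ (tail-⊛ f h n) (tail-⊛ g h n) ⟨
  (f ⊛ h ⊖ g ⊛ h) (suc n)                                                ∎
  where
  open ≡-Reasoning
  regroup : ∀ a b c x y → (a -ℤ b) *ℤ c +ℤ (x -ℤ y) ≡ (a *ℤ c +ℤ x) -ℤ (b *ℤ c +ℤ y)
  regroup = solve-∀

⊛-assoc : ∀ f g h → ((f ⊛ g) ⊛ h) ≈ₛ (f ⊛ (g ⊛ h))
⊛-assoc f g h zero = begin
  ((f ⊛ g) ⊛ h) 0     ≡⟨ trans (⊛-zero (f ⊛ g) h) (cong (_*ℤ h 0) (⊛-zero f g)) ⟩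
  f 0 *ℤ g 0 *ℤ h 0   ≡⟨ ℤ.*-assoc (f 0) (g 0) (h 0) ⟩
  f 0 *ℤ (g 0 *ℤ h 0) ≡⟨ trans (⊛-zero f (g ⊛ h)) (cong (f 0 *ℤ_) (⊛-zero g h)) ⟨
  (f ⊛ (g ⊛ h)) 0     ∎
  where open ≡-Reasoning
⊛-assoc f g h (suc n) = begin
  ((f ⊛ g) ⊛ h) (suc n)                                          ≡⟨ tail-⊛ (f ⊛ g) h n ⟩
  (f ⊛ g) 0 *ℤ h (suc n) +ℤ (tail (f ⊛ g) ⊛ h) n                 ≡⟨ cong₂ _+ℤ_ (cong (_*ℤ h (suc n)) (⊛-zero f g)) tail-expanded ⟩
  f 0 *ℤ g 0 *ℤ h (suc n) +ℤ (f 0 *ℤ (tail g ⊛ h) n +ℤ (tail f ⊛ (g ⊛ h)) n) ≡⟨ regroup (f 0) (g 0) (h (suc n)) _ _ ⟩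
  f 0 *ℤ (g 0 *ℤ h (suc n) +ℤ (tail g ⊛ h) n) +ℤ (tail f ⊛ (g ⊛ h)) n ≡⟨ cong (λ x → f 0 *ℤ x +ℤ (tail f ⊛ (g ⊛ h)) n) (tail-⊛ g h n) ⟨
  f 0 *ℤ (g ⊛ h) (suc n) +ℤ (tail f ⊛ (g ⊛ h)) n                 ≡⟨ tail-⊛ f (g ⊛ h) n ⟨
  (f ⊛ (g ⊛ h)) (suc n)                                          ∎
  where
  open ≡-Reasoning
  regroup : ∀ a b c x y → a *ℤ b *ℤ c +ℤ (a *ℤ x +ℤ y) ≡ a *ℤ (b *ℤ c +ℤ x) +ℤ y
  regroup = solve-∀
  tail-expanded : (tail (f ⊛ g) ⊛ h) n ≡ f 0 *ℤ (tail g ⊛ h) n +ℤ (tail f ⊛ (g ⊛ h)) n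
  tail-expanded = begin
    (tail (f ⊛ g) ⊛ h) n                            ≡⟨ ⊛-congˡ h (tail-⊛ f g) n ⟩
    ((f 0 ·ₛ tail g ⊕ tail f ⊛ g) ⊛ h) n            ≡⟨ ⊛-distribʳ-⊕ (f 0 ·ₛ tail g) (tail f ⊛ g) h n ⟩
    ((f 0 ·ₛ tail g) ⊛ h) n +ℤ ((tail f ⊛ g) ⊛ h) n ≡⟨ cong₂ _+ℤ_ (⊛-scaleˡ (f 0) (tail g) h n) (⊛-assoc (tail f) g h n) ⟩
    f 0 *ℤ (tail g ⊛ h) n +ℤ (tail f ⊛ (g ⊛ h)) n   ∎

mutual
  ⊛-comm : ∀ f g → (f ⊛ g) ≈ₛ (g ⊛ f)
  ⊛-comm f g zero = trans (⊛-zero f g) (trans (ℤ.*-comm (f 0) (g 0)) (sym (⊛-zero g f)))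
  ⊛-comm f g (suc n) = begin
    (f ⊛ g) (suc n)                    ≡⟨ tail-⊛ f g n ⟩
    f 0 *ℤ g (suc n) +ℤ (tail f ⊛ g) n ≡⟨ cong (f 0 *ℤ g (suc n) +ℤ_) (⊛-comm (tail f) g n) ⟩
    f 0 *ℤ g (suc n) +ℤ (g ⊛ tail f) n ≡⟨ ⊛-comm-heads f g n ⟩
    g 0 *ℤ f (suc n) +ℤ (f ⊛ tail g) n ≡⟨ cong (g 0 *ℤ f (suc n) +ℤ_) (⊛-comm (tail g) f n) ⟨
    g 0 *ℤ f (suc n) +ℤ (tail g ⊛ f) n ≡⟨ tail-⊛ g f n ⟨
    (g ⊛ f) (suc n)                    ∎
    where open ≡-Reasoning

  ⊛-comm-heads : ∀ f g n → f 0 *ℤ g (suc n) +ℤ (g ⊛ tail f) n ≡ g 0 *ℤ f (suc n) +ℤ (f ⊛ tail g) n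
  ⊛-comm-heads f g zero = begin
    f 0 *ℤ g 1 +ℤ (g ⊛ tail f) 0 ≡⟨ cong (f 0 *ℤ g 1 +ℤ_) (⊛-zero g (tail f)) ⟩
    f 0 *ℤ g 1 +ℤ g 0 *ℤ f 1     ≡⟨ ℤ.+-comm (f 0 *ℤ g 1) (g 0 *ℤ f 1) ⟩
    g 0 *ℤ f 1 +ℤ f 0 *ℤ g 1     ≡⟨ cong (g 0 *ℤ f 1 +ℤ_) (⊛-zero f (tail g)) ⟨
    g 0 *ℤ f 1 +ℤ (f ⊛ tail g) 0 ∎
    where open ≡-Reasoning
  ⊛-comm-heads f g (suc m) = begin
    f 0 *ℤ g (suc (suc m)) +ℤ (g ⊛ tail f) (suc m)                           ≡⟨ cong (f 0 *ℤ g (suc (suc m)) +ℤ_) (tail-⊛ g (tail f) m) ⟩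
    f 0 *ℤ g (suc (suc m)) +ℤ (g 0 *ℤ f (suc (suc m)) +ℤ (tail g ⊛ tail f) m)       ≡⟨ cong (λ x → f 0 *ℤ g (suc (suc m)) +ℤ (g 0 *ℤ f (suc (suc m)) +ℤ x)) (⊛-comm (tail g) (tail f) m) ⟩
    f 0 *ℤ g (suc (suc m)) +ℤ (g 0 *ℤ f (suc (suc m)) +ℤ (tail f ⊛ tail g) m)       ≡⟨ +-exchange (f 0 *ℤ g (suc (suc m))) (g 0 *ℤ f (suc (suc m))) _ ⟩
    g 0 *ℤ f (suc (suc m)) +ℤ (f 0 *ℤ g (suc (suc m)) +ℤ (tail f ⊛ tail g) m)       ≡⟨ cong (g 0 *ℤ f (suc (suc m)) +ℤ_) (tail-⊛ f (tail g) m) ⟨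
    g 0 *ℤ f (suc (suc m)) +ℤ (f ⊛ tail g) (suc m)                           ∎
    where
    open ≡-Reasoning
    +-exchange : ∀ x y z → x +ℤ (y +ℤ z) ≡ y +ℤ (x +ℤ z)
    +-exchange = solve-∀

⊛-identityʳ : ∀ f → (f ⊛ one) ≈ₛ f
⊛-identityʳ f n = trans (⊛-comm f one n) (⊛-identityˡ f n)

⊛-distribˡ-⊕ : ∀ h f g → (h ⊛ (f ⊕ g)) ≈ₛ (h ⊛ f ⊕ h ⊛ g)
⊛-distribˡ-⊕ h f g n = trans (⊛-comm h (f ⊕ g) n)
  (trans (⊛-distribʳ-⊕ f g h n) (cong₂ _+ℤ_ (⊛-comm f h n) (⊛-comm g h n)))

≈ₛ-setoid : Setoid _ _
≈ₛ-setoid = record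
  { Carrier       = Series
  ; _≈_           = _≈ₛ_
  ; isEquivalence = record
    { refl  = λ _ → refl
    ; sym   = λ f≈g n → sym (f≈g n)
    ; trans = λ f≈g g≈h n → trans (f≈g n) (g≈h n)
    }
  }

⊛-commutativeMonoid : CommutativeMonoid _ _
⊛-commutativeMonoid = record
  { Carrier = Series
  ; _≈_     = _≈ₛ_
  ; _∙_     = _⊛_
  ; ε       = one
  ; isCommutativeMonoid = record
    { isMonoid = record
      { isSemigroup = record
        { isMagma = record
          { isEquivalence = Setoid.isEquivalence ≈ₛ-setoid
          ; ∙-cong        = λ {f} {f′} {g} {g′} → ⊛-cong {f} {f′} {g} {g′}
          }
        ; assoc = ⊛-assoc
        }
      ; identity = ⊛-identityˡ , ⊛-identityʳ
      }
    ; comm = ⊛-comm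
    }
  }

open CommutativeMonoidSolver ⊛-commutativeMonoid using (solve; _⊜_) renaming (_⊕_ to _⊙_)

^ₛ-cong : ∀ {f g} m → f ≈ₛ g → (f ^ₛ m) ≈ₛ (g ^ₛ m)
^ₛ-cong zero f≈g = λ _ → refl
^ₛ-cong {f} {g} (suc m) f≈g = ⊛-cong {f} {g} {f ^ₛ m} {g ^ₛ m} f≈g (^ₛ-cong m f≈g)

^ₛ-distribʳ-⊛ : ∀ f g m → ((f ⊛ g) ^ₛ m) ≈ₛ (f ^ₛ m ⊛ g ^ₛ m)
^ₛ-distribʳ-⊛ f g zero n = sym (⊛-identityˡ one n)
^ₛ-distribʳ-⊛ f g (suc m) n = trans (⊛-congʳ (f ⊛ g) (^ₛ-distribʳ-⊛ f g m) n)
  (solve 4 (λ a b c d → (a ⊙ b) ⊙ (c ⊙ d) ⊜ (a ⊙ c) ⊙ (b ⊙ d)) (λ _ → refl) f g (f ^ₛ m) (g ^ₛ m) n)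

⊛-constant-one : ∀ f g → f 0 ≡ + 1 → g 0 ≡ + 1 → (f ⊛ g) 0 ≡ + 1
⊛-constant-one f g f₀≡1 g₀≡1 = trans (⊛-zero f g) (cong₂ _*ℤ_ f₀≡1 g₀≡1)

^ₛ-constant-one : ∀ f m → f 0 ≡ + 1 → (f ^ₛ m) 0 ≡ + 1
^ₛ-constant-one f zero f₀≡1 = refl
^ₛ-constant-one f (suc m) f₀≡1 = ⊛-constant-one f (f ^ₛ m) f₀≡1 (^ₛ-constant-one f m f₀≡1)

length-invL : ∀ f n → length (invL f n) ≡ suc n
length-invL f zero = refl
length-invL f (suc n) = trans (length-++ (invL f n)) (trans (cong (_+ 1) (length-invL f n)) (ℕ.+-comm (suc n) 1))

nth-++ˡ : ∀ xs ys {j} → j < length xs → nth (xs ++ ys) j ≡ nth xs j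
nth-++ˡ (x ∷ xs) ys {zero} _ = refl
nth-++ˡ (x ∷ xs) ys {suc j} (s≤s j<n) = nth-++ˡ xs ys j<n

nth-++-last : ∀ xs y {j} → length xs ≡ j → nth (xs ++ [ y ]) j ≡ y
nth-++-last [] y refl = refl
nth-++-last (x ∷ xs) y refl = nth-++-last xs y refl

nth-invL : ∀ f {n j} → j ≤ n → nth (invL f n) j ≡ inv f j
nth-invL f {zero} {zero} _ = refl
nth-invL f {suc n} {j} j≤1+n with ℕ.m≤n⇒m<n∨m≡n j≤1+n
... | inj₂ refl = refl
... | inj₁ (s≤s j≤n) =
  trans (nth-++ˡ (invL f n) _ (subst (j <_) (sym (length-invL f n)) (s≤s j≤n))) (nth-invL f j≤n)

inv-suc : ∀ f n → inv f (suc n) ≡ - (tail f ⊛ inv f) n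
inv-suc f n = trans (nth-++-last (invL f n) _ (length-invL f n))
  (cong (λ xs → - foldr _+ℤ_ (+ 0) xs)
    (map-cong (λ i → cong (f (suc i) *ℤ_) (nth-invL f (ℕ.m∸n≤m n i))) (upTo (suc n))))

⊛-inverseʳ : ∀ f → f 0 ≡ + 1 → (f ⊛ inv f) ≈ₛ one
⊛-inverseʳ f f₀≡1 zero = ⊛-constant-one f (inv f) f₀≡1 refl
⊛-inverseʳ f f₀≡1 (suc n) = begin
  (f ⊛ inv f) (suc n)                            ≡⟨ tail-⊛ f (inv f) n ⟩
  f 0 *ℤ inv f (suc n) +ℤ (tail f ⊛ inv f) n      ≡⟨ cong₂ (λ a b → a *ℤ b +ℤ (tail f ⊛ inv f) n) f₀≡1 (inv-suc f n) ⟩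
  + 1 *ℤ - (tail f ⊛ inv f) n +ℤ (tail f ⊛ inv f) n ≡⟨ cancel ((tail f ⊛ inv f) n) ⟩
  + 0                                            ∎
  where
  open ≡-Reasoning
  cancel : ∀ x → + 1 *ℤ (- x) +ℤ x ≡ + 0
  cancel = solve-∀

⊛-inverseˡ : ∀ f → f 0 ≡ + 1 → (inv f ⊛ f) ≈ₛ one
⊛-inverseˡ f f₀≡1 n = trans (⊛-comm (inv f) f n) (⊛-inverseʳ f f₀≡1 n)

inv-unique : ∀ f g → f 0 ≡ + 1 → (f ⊛ g) ≈ₛ one → g ≈ₛ inv f
inv-unique f g f₀≡1 fg≈1 = begin
  g                 ≈⟨ ⊛-identityˡ g ⟨
  one ⊛ g           ≈⟨ ⊛-congˡ g (⊛-inverseˡ f f₀≡1) ⟨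
  (inv f ⊛ f) ⊛ g   ≈⟨ ⊛-assoc (inv f) f g ⟩
  inv f ⊛ (f ⊛ g)   ≈⟨ ⊛-congʳ (inv f) fg≈1 ⟩
  inv f ⊛ one       ≈⟨ ⊛-identityʳ (inv f) ⟩
  inv f             ∎
  where open SetoidReasoning ≈ₛ-setoid

inv-suc-of-negated-tail : ∀ f h → (∀ n → f (suc n) ≡ - h n) → ∀ n → inv f (suc n) ≡ (h ⊛ inv f) n
inv-suc-of-negated-tail f h tail≡-h n = begin
  inv f (suc n)                        ≡⟨ inv-suc f n ⟩
  - (tail f ⊛ inv f) n                 ≡⟨ cong -_ (⊛-congˡ (inv f) tail≡-1·h n) ⟩
  - ((-1ℤ ·ₛ h) ⊛ inv f) n             ≡⟨ cong -_ (⊛-scaleˡ -1ℤ h (inv f) n) ⟩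
  - (-1ℤ *ℤ (h ⊛ inv f) n)             ≡⟨ cong -_ (ℤ.-1*i≡-i _) ⟩
  - - (h ⊛ inv f) n                    ≡⟨ ℤ.neg-involutive _ ⟩
  (h ⊛ inv f) n                        ∎
  where
  open ≡-Reasoning
  tail≡-1·h : tail f ≈ₛ (-1ℤ ·ₛ h)
  tail≡-1·h m = trans (tail≡-h m) (sym (ℤ.-1*i≡-i (h m)))

X⊛-zero : ∀ g → (X ⊛ g) 0 ≡ + 0
X⊛-zero g = ⊛-zero X g

X⊛-suc : ∀ g n → (X ⊛ g) (suc n) ≡ g n
X⊛-suc g n =
  trans (tail-⊛ X g n) (trans (ℤ.+-identityˡ _) (trans (⊛-congˡ g tail-X n) (⊛-identityˡ g n)))
  where
  tail-X : tail X ≈ₛ one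
  tail-X zero = refl
  tail-X (suc _) = refl

X^ₛ⊛-coeff : ∀ p g n → (X ^ₛ p ⊛ g) n ≡ (if n <ᵇ p then + 0 else g (n ∸ p))
X^ₛ⊛-coeff zero g n = ⊛-identityˡ g n
X^ₛ⊛-coeff (suc p) g zero = trans (⊛-assoc X (X ^ₛ p) g 0) (X⊛-zero (X ^ₛ p ⊛ g))
X^ₛ⊛-coeff (suc p) g (suc n) =
  trans (⊛-assoc X (X ^ₛ p) g (suc n)) (trans (X⊛-suc (X ^ₛ p ⊛ g) n) (X^ₛ⊛-coeff p g n))

inv-one⊖X : ∀ n → inv (one ⊖ X) n ≡ + 1
inv-one⊖X zero = refl
inv-one⊖X (suc n) = trans (inv-suc-of-negated-tail (one ⊖ X) one tail≡-one n)
  (trans (⊛-identityˡ (inv (one ⊖ X)) n) (inv-one⊖X n))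
  where
  tail≡-one : ∀ m → (one ⊖ X) (suc m) ≡ - one m
  tail≡-one zero = refl
  tail≡-one (suc _) = refl

𝟙 : Bool → ℤ
𝟙 b = if b then + 1 else + 0

isEven : ℕ → Bool
isEven n = n % 2 ≡ᵇ 0

inv-one⊖X² : ∀ n → inv (one ⊖ X ^ₛ 2) n ≡ 𝟙 (isEven n)
inv-one⊖X² zero = refl
inv-one⊖X² (suc n) = trans (inv-suc-of-negated-tail (one ⊖ X ^ₛ 2) X tail≡-X n) (coeff n)
  where
  tail≡-X : ∀ m → (one ⊖ X ^ₛ 2) (suc m) ≡ - X m
  tail≡-X m = trans (cong (+ 0 -ℤ_) (trans (X⊛-suc (X ⊛ one) m) (⊛-identityʳ X m))) (ℤ.+-identityˡ (- X m))
  coeff : ∀ m → (X ⊛ inv (one ⊖ X ^ₛ 2)) m ≡ 𝟙 (isEven (suc m))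
  coeff zero = X⊛-zero (inv (one ⊖ X ^ₛ 2))
  coeff (suc m) = trans (X⊛-suc (inv (one ⊖ X ^ₛ 2)) m) (inv-one⊖X² m)

inEv>-via-δ : ∀ k n → inEv> k n ≡ (if n <ᵇ k + δ k then false else isEven (n ∸ (k + δ k)))
inEv>-via-δ zero zero = refl
inEv>-via-δ zero (suc zero) = refl
inEv>-via-δ zero (suc (suc n)) = ∧-identityʳ (isEven n)
inEv>-via-δ (suc zero) zero = refl
inEv>-via-δ (suc zero) (suc zero) = refl
inEv>-via-δ (suc zero) (suc (suc n)) = ∧-identityʳ (isEven n)
inEv>-via-δ (suc (suc k)) zero = refl
inEv>-via-δ (suc (suc k)) (suc zero) = refl
inEv>-via-δ (suc (suc k)) (suc (suc n)) = inEv>-via-δ k n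

X^[k+δ]⊛inv-one⊖X²-coeff : ∀ k n → (X ^ₛ (k + δ k) ⊛ inv (one ⊖ X ^ₛ 2)) n ≡ 𝟙 (inEv> k n)
X^[k+δ]⊛inv-one⊖X²-coeff k n
  rewrite X^ₛ⊛-coeff (k + δ k) (inv (one ⊖ X ^ₛ 2)) n | inEv>-via-δ k n
  with n <ᵇ k + δ k
... | true  = refl
... | false = inv-one⊖X² (n ∸ (k + δ k))

partsₛ : (ℕ → Bool) → Series
partsₛ q zero = + 0
partsₛ q (suc j) = 𝟙 (q (suc j))

∉Ev> : ℕ → ℕ → Bool
∉Ev> k j = not (inEv> k j)

U≈partsₛ-all : U ≈ₛ partsₛ (λ _ → true)
U≈partsₛ-all zero = X⊛-zero (inv (one ⊖ X))
U≈partsₛ-all (suc j) = trans (X⊛-suc (inv (one ⊖ X)) j) (inv-one⊖X j)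

S≈partsₛ-∉Ev> : ∀ k → S k ≈ₛ partsₛ (∉Ev> k)
S≈partsₛ-∉Ev> k zero =
  cong₂ _-ℤ_ (X⊛-zero (inv (one ⊖ X))) (X^[k+δ]⊛inv-one⊖X²-coeff k 0)
S≈partsₛ-∉Ev> k (suc j) = trans
  (cong₂ _-ℤ_ (trans (X⊛-suc (inv (one ⊖ X)) j) (inv-one⊖X j)) (X^[k+δ]⊛inv-one⊖X²-coeff k (suc j)))
  (one-minus-𝟙 (inEv> k (suc j)))
  where
  one-minus-𝟙 : ∀ b → + 1 -ℤ 𝟙 b ≡ 𝟙 (not b)
  one-minus-𝟙 true = refl
  one-minus-𝟙 false = refl

countₛ : (List ℕ → Bool) → Series
countₛ p n = + length (filterᵇ p (compositions n))

compsF-fuel : ∀ f g {n} → n ≤ f → n ≤ g → compsF f n ≡ compsF g n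
compsF-fuel zero zero {zero} _ _ = refl
compsF-fuel zero (suc g) {zero} _ _ = refl
compsF-fuel (suc f) zero {zero} _ _ = refl
compsF-fuel (suc f) (suc g) {zero} _ _ = refl
compsF-fuel (suc f) (suc g) {suc n} (s≤s n≤f) (s≤s n≤g) =
  cong concat (map-cong (λ m → cong (map (suc m ∷_))
    (compsF-fuel f g (ℕ.≤-trans (ℕ.m∸n≤m n m) n≤f) (ℕ.≤-trans (ℕ.m∸n≤m n m) n≤g))) (upTo (suc n)))

+length-filterᵇ-concat : ∀ {A : Set} (p : A → Bool) xss →
  + length (filterᵇ p (concat xss)) ≡ foldr _+ℤ_ (+ 0) (map (λ xs → + length (filterᵇ p xs)) xss)
+length-filterᵇ-concat p [] = refl
+length-filterᵇ-concat p (xs ∷ xss) = begin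
  + length (filterᵇ p (xs ++ concat xss))                     ≡⟨ cong (+_ ∘ length) (filter-++ (T? ∘ p) xs (concat xss)) ⟩
  + length (filterᵇ p xs ++ filterᵇ p (concat xss))           ≡⟨ cong +_ (length-++ (filterᵇ p xs)) ⟩
  + (length (filterᵇ p xs) + length (filterᵇ p (concat xss))) ≡⟨ ℤ.pos-+ (length (filterᵇ p xs)) _ ⟩
  + length (filterᵇ p xs) +ℤ + length (filterᵇ p (concat xss)) ≡⟨ cong (+ length (filterᵇ p xs) +ℤ_) (+length-filterᵇ-concat p xss) ⟩
  foldr _+ℤ_ (+ 0) (map (λ ys → + length (filterᵇ p ys)) (xs ∷ xss)) ∎
  where open ≡-Reasoning

length-filterᵇ-map : ∀ {A B : Set} (p : B → Bool) (f : A → B) (p′ : A → Bool) →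
  (∀ x → p (f x) ≡ p′ x) → ∀ xs → length (filterᵇ p (map f xs)) ≡ length (filterᵇ p′ xs)
length-filterᵇ-map p f p′ p∘f≡p′ [] = refl
length-filterᵇ-map p f p′ p∘f≡p′ (x ∷ xs) rewrite p∘f≡p′ x with p′ x
... | true  = cong suc (length-filterᵇ-map p f p′ p∘f≡p′ xs)
... | false = length-filterᵇ-map p f p′ p∘f≡p′ xs

length-filterᵇ-false : ∀ {A : Set} (xs : List A) → length (filterᵇ (λ _ → false) xs) ≡ 0
length-filterᵇ-false [] = refl
length-filterᵇ-false (x ∷ xs) = length-filterᵇ-false xs

+length-filterᵇ-∧ˡ : ∀ {A : Set} b (r : A → Bool) xs →
  + length (filterᵇ (λ x → b ∧ r x) xs) ≡ 𝟙 b *ℤ + length (filterᵇ r xs)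
+length-filterᵇ-∧ˡ true r xs = sym (ℤ.*-identityˡ _)
+length-filterᵇ-∧ˡ false r xs = cong +_ (length-filterᵇ-false xs)

countₛ-split-first-part : ∀ p q r → (∀ a c → p (a ∷ c) ≡ q a ∧ r c) →
  countₛ p ≈ₛ (const (𝟙 (p [])) ⊕ partsₛ q ⊛ countₛ r)
countₛ-split-first-part p q r p-cons zero with p []
... | true  = refl
... | false = refl
countₛ-split-first-part p q r p-cons (suc n) = begin
  countₛ p (suc n)
    ≡⟨ +length-filterᵇ-concat p (map firstPart (upTo (suc n))) ⟩
  foldr _+ℤ_ (+ 0) (map (λ cs → + length (filterᵇ p cs)) (map firstPart (upTo (suc n))))
    ≡⟨ cong (foldr _+ℤ_ (+ 0)) (map-∘ {g = λ cs → + length (filterᵇ p cs)} {f = firstPart} (upTo (suc n))) ⟨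
  foldr _+ℤ_ (+ 0) (map (λ m → + length (filterᵇ p (firstPart m))) (upTo (suc n)))
    ≡⟨ cong (foldr _+ℤ_ (+ 0)) (map-cong count-firstPart (upTo (suc n))) ⟩
  (tail (partsₛ q) ⊛ countₛ r) n
    ≡⟨ ℤ.+-identityˡ _ ⟨
  + 0 +ℤ (tail (partsₛ q) ⊛ countₛ r) n
    ≡⟨ tail-⊛ (partsₛ q) (countₛ r) n ⟨
  (partsₛ q ⊛ countₛ r) (suc n)
    ≡⟨ ℤ.+-identityˡ _ ⟨
  + 0 +ℤ (partsₛ q ⊛ countₛ r) (suc n)
    ∎
  where
  open ≡-Reasoning
  firstPart : ℕ → List (List ℕ)
  firstPart m = map (suc m ∷_) (compsF n (n ∸ m))
  count-firstPart : ∀ m → + length (filterᵇ p (firstPart m)) ≡ 𝟙 (q (suc m)) *ℤ countₛ r (n ∸ m)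
  count-firstPart m = begin
    + length (filterᵇ p (firstPart m))
      ≡⟨ cong +_ (length-filterᵇ-map p (suc m ∷_) _ (p-cons (suc m)) (compsF n (n ∸ m))) ⟩
    + length (filterᵇ (λ c → q (suc m) ∧ r c) (compsF n (n ∸ m)))
      ≡⟨ cong (λ cs → + length (filterᵇ (λ c → q (suc m) ∧ r c) cs))
              (compsF-fuel n (n ∸ m) (ℕ.m∸n≤m n m) ℕ.≤-refl) ⟩
    + length (filterᵇ (λ c → q (suc m) ∧ r c) (compositions (n ∸ m)))
      ≡⟨ +length-filterᵇ-∧ˡ (q (suc m)) r (compositions (n ∸ m)) ⟩
    𝟙 (q (suc m)) *ℤ countₛ r (n ∸ m)
      ∎

<ᵇ-suc : ∀ m n → (m <ᵇ suc n) ≡ (m ≤ᵇ n)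
<ᵇ-suc zero n = refl
<ᵇ-suc (suc m) n = refl

good-suc-∷ : ∀ k ℓ a c → good k (suc ℓ) (a ∷ c) ≡ ∉Ev> k a ∧ good k ℓ c
good-suc-∷ k ℓ a c rewrite <ᵇ-suc ℓ (length c) with ℓ ≤ᵇ length c
... | true  = refl
... | false = sym (∧-zeroʳ (∉Ev> k a))

Lgf-zero-recurrence : ∀ k → Lgf k 0 ≈ₛ (one ⊕ partsₛ (λ _ → true) ⊛ Lgf k 0)
Lgf-zero-recurrence k = countₛ-split-first-part (good k 0) (λ _ → true) (good k 0) (λ _ _ → refl)

Lgf-suc-recurrence : ∀ k ℓ → Lgf k (suc ℓ) ≈ₛ (partsₛ (∉Ev> k) ⊛ Lgf k ℓ)
Lgf-suc-recurrence k ℓ n =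
  trans (countₛ-split-first-part (good k (suc ℓ)) (∉Ev> k) (good k ℓ) (good-suc-∷ k ℓ) n) (zero-⊕ n)
  where
  zero-⊕ : (const (+ 0) ⊕ partsₛ (∉Ev> k) ⊛ Lgf k ℓ) ≈ₛ (partsₛ (∉Ev> k) ⊛ Lgf k ℓ)
  zero-⊕ zero = ℤ.+-identityˡ _
  zero-⊕ (suc m) = ℤ.+-identityˡ _

Lgf-zero≈inv-one⊖U : ∀ k → Lgf k 0 ≈ₛ inv (one ⊖ U)
Lgf-zero≈inv-one⊖U k = inv-unique (one ⊖ U) (Lgf k 0) refl λ n → begin
  ((one ⊖ U) ⊛ Lgf k 0) n                  ≡⟨ ⊛-distribʳ-⊖ one U (Lgf k 0) n ⟩
  (one ⊛ Lgf k 0) n -ℤ (U ⊛ Lgf k 0) n     ≡⟨ cong₂ _-ℤ_ (trans (⊛-identityˡ (Lgf k 0) n) (Lgf-zero-recurrence k n)) (⊛-congˡ (Lgf k 0) U≈partsₛ-all n) ⟩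
  (one n +ℤ U⊛Lgf₀ n) -ℤ U⊛Lgf₀ n      ≡⟨ +-minus (one n) (U⊛Lgf₀ n) ⟩
  one n                                    ∎
  where
  open ≡-Reasoning
  U⊛Lgf₀ : Series
  U⊛Lgf₀ = partsₛ (λ _ → true) ⊛ Lgf k 0
  +-minus : ∀ a b → (a +ℤ b) -ℤ b ≡ a
  +-minus = solve-∀

Lgf≈S^ℓ⊛inv-one⊖U : ∀ k ℓ → Lgf k ℓ ≈ₛ (S k ^ₛ ℓ ⊛ inv (one ⊖ U))
Lgf≈S^ℓ⊛inv-one⊖U k zero n = trans (Lgf-zero≈inv-one⊖U k n) (sym (⊛-identityˡ (inv (one ⊖ U)) n))
Lgf≈S^ℓ⊛inv-one⊖U k (suc ℓ) = begin
  Lgf k (suc ℓ)                            ≈⟨ Lgf-suc-recurrence k ℓ ⟩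
  partsₛ (∉Ev> k) ⊛ Lgf k ℓ                ≈⟨ ⊛-cong {partsₛ (∉Ev> k)} {S k} (λ n → sym (S≈partsₛ-∉Ev> k n)) (Lgf≈S^ℓ⊛inv-one⊖U k ℓ) ⟩
  S k ⊛ (S k ^ₛ ℓ ⊛ inv (one ⊖ U))         ≈⟨ ⊛-assoc (S k) (S k ^ₛ ℓ) (inv (one ⊖ U)) ⟨
  S k ^ₛ suc ℓ ⊛ inv (one ⊖ U)             ∎
  where open SetoidReasoning ≈ₛ-setoid

inv-one⊖U : inv (one ⊖ U) ≈ₛ ((one ⊖ X) ⊛ inv (one ⊖ const (+ 2) ⊛ X))
inv-one⊖U n = sym (inv-unique (one ⊖ U) ((one ⊖ X) ⊛ inv D) refl product≈one n)
  where
  D : Series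
  D = one ⊖ const (+ 2) ⊛ X
  one⊖U⊛one⊖X : ((one ⊖ U) ⊛ (one ⊖ X)) ≈ₛ D
  one⊖U⊛one⊖X = begin
    (one ⊖ U) ⊛ (one ⊖ X)                     ≈⟨ ⊛-distribʳ-⊖ one U (one ⊖ X) ⟩
    one ⊛ (one ⊖ X) ⊖ U ⊛ (one ⊖ X)           ≈⟨ ⊖-cong (⊛-identityˡ (one ⊖ X)) (⊛-assoc X (inv (one ⊖ X)) (one ⊖ X)) ⟩
    (one ⊖ X) ⊖ X ⊛ (inv (one ⊖ X) ⊛ (one ⊖ X)) ≈⟨ ⊖-cong {one ⊖ X} (λ _ → refl) (⊛-congʳ X (⊛-inverseˡ (one ⊖ X) refl)) ⟩
    (one ⊖ X) ⊖ X ⊛ one                       ≈⟨ ⊖-cong {one ⊖ X} (λ _ → refl) (⊛-identityʳ X) ⟩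
    (one ⊖ X) ⊖ X                             ≈⟨ (λ m → trans (twice (one m) (X m)) (cong (one m -ℤ_) (sym (const-⊛ (+ 2) X m)))) ⟩
    D                                          ∎
    where
    open SetoidReasoning ≈ₛ-setoid
    twice : ∀ a b → a -ℤ b -ℤ b ≡ a -ℤ + 2 *ℤ b
    twice = solve-∀
  product≈one : ((one ⊖ U) ⊛ ((one ⊖ X) ⊛ inv D)) ≈ₛ one
  product≈one = begin
    (one ⊖ U) ⊛ ((one ⊖ X) ⊛ inv D) ≈⟨ ⊛-assoc (one ⊖ U) (one ⊖ X) (inv D) ⟨
    ((one ⊖ U) ⊛ (one ⊖ X)) ⊛ inv D ≈⟨ ⊛-congˡ (inv D) one⊖U⊛one⊖X ⟩
    D ⊛ inv D                       ≈⟨ ⊛-inverseʳ D refl ⟩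
    one                             ∎
    where open SetoidReasoning ≈ₛ-setoid

one⊖X²≈[one⊖X]⊛[one⊕X] : (one ⊖ X ^ₛ 2) ≈ₛ ((one ⊖ X) ⊛ (one ⊕ X))
one⊖X²≈[one⊖X]⊛[one⊕X] = begin
  one ⊖ X ^ₛ 2                           ≈⟨ (λ n → sym (cancel-middle (one n) (X n) ((X ^ₛ 2) n))) ⟩
  (one ⊕ X) ⊖ (X ⊕ X ^ₛ 2)               ≈⟨ ⊖-cong {one ⊕ X} (λ _ → refl) (λ n → cong₂ _+ℤ_ (⊛-identityʳ X n) (sym (⊛-congʳ X (⊛-identityʳ X) n))) ⟨
  (one ⊕ X) ⊖ (X ⊛ one ⊕ X ⊛ X)          ≈⟨ ⊖-cong (⊛-identityˡ (one ⊕ X)) (⊛-distribˡ-⊕ X one X) ⟨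
  one ⊛ (one ⊕ X) ⊖ X ⊛ (one ⊕ X)        ≈⟨ ⊛-distribʳ-⊖ one X (one ⊕ X) ⟨
  (one ⊖ X) ⊛ (one ⊕ X)                  ∎
  where
  open SetoidReasoning ≈ₛ-setoid
  cancel-middle : ∀ a b c → (a +ℤ b) -ℤ (b +ℤ c) ≡ a -ℤ c
  cancel-middle = solve-∀

S⊛[one⊖X]⊛[one⊕X] : ∀ k → (S k ⊛ ((one ⊖ X) ⊛ (one ⊕ X))) ≈ₛ (X ⊛ (one ⊕ X) ⊖ X ^ₛ (k + δ k))
S⊛[one⊖X]⊛[one⊕X] k = begin
  S k ⊛ (P ⊛ B)                         ≈⟨ ⊛-distribʳ-⊖ (X ⊛ G) (X ^ₛ (k + δ k) ⊛ J) (P ⊛ B) ⟩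
  (X ⊛ G) ⊛ (P ⊛ B) ⊖ (X ^ₛ (k + δ k) ⊛ J) ⊛ (P ⊛ B) ≈⟨ ⊖-cong geometric-part even-part ⟩
  X ⊛ B ⊖ X ^ₛ (k + δ k)                 ∎
  where
  open SetoidReasoning ≈ₛ-setoid
  P B G J : Series
  P = one ⊖ X
  B = one ⊕ X
  G = inv (one ⊖ X)
  J = inv (one ⊖ X ^ₛ 2)
  geometric-part : ((X ⊛ G) ⊛ (P ⊛ B)) ≈ₛ (X ⊛ B)
  geometric-part = begin
    (X ⊛ G) ⊛ (P ⊛ B)   ≈⟨ solve 4 (λ x g p b → (x ⊙ g) ⊙ (p ⊙ b) ⊜ x ⊙ ((g ⊙ p) ⊙ b)) (λ _ → refl) X G P B ⟩
    X ⊛ ((G ⊛ P) ⊛ B)   ≈⟨ ⊛-congʳ X (⊛-congˡ B (⊛-inverseˡ (one ⊖ X) refl)) ⟩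
    X ⊛ (one ⊛ B)       ≈⟨ ⊛-congʳ X (⊛-identityˡ B) ⟩
    X ⊛ B               ∎
  even-part : ((X ^ₛ (k + δ k) ⊛ J) ⊛ (P ⊛ B)) ≈ₛ (X ^ₛ (k + δ k))
  even-part = begin
    (X ^ₛ (k + δ k) ⊛ J) ⊛ (P ⊛ B)      ≈⟨ ⊛-assoc (X ^ₛ (k + δ k)) J (P ⊛ B) ⟩
    X ^ₛ (k + δ k) ⊛ (J ⊛ (P ⊛ B))      ≈⟨ ⊛-congʳ (X ^ₛ (k + δ k)) (⊛-congʳ J one⊖X²≈[one⊖X]⊛[one⊕X]) ⟨
    X ^ₛ (k + δ k) ⊛ (J ⊛ (one ⊖ X ^ₛ 2)) ≈⟨ ⊛-congʳ (X ^ₛ (k + δ k)) (⊛-inverseˡ (one ⊖ X ^ₛ 2) refl) ⟩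
    X ^ₛ (k + δ k) ⊛ one                ≈⟨ ⊛-identityʳ (X ^ₛ (k + δ k)) ⟩
    X ^ₛ (k + δ k)                      ∎

invOneMinusXPowPred⊛[one⊖X]^ : ∀ ℓ → (invOneMinusXPowPred ℓ ⊛ (one ⊖ X) ^ₛ ℓ) ≈ₛ (one ⊖ X)
invOneMinusXPowPred⊛[one⊖X]^ zero = ⊛-identityʳ (one ⊖ X)
invOneMinusXPowPred⊛[one⊖X]^ (suc j) = begin
  inv (P ^ₛ j) ⊛ (P ⊛ P ^ₛ j)       ≈⟨ solve 3 (λ a p b → a ⊙ (p ⊙ b) ⊜ (a ⊙ b) ⊙ p) (λ _ → refl) (inv (P ^ₛ j)) P (P ^ₛ j) ⟩
  (inv (P ^ₛ j) ⊛ P ^ₛ j) ⊛ P       ≈⟨ ⊛-congˡ P (⊛-inverseˡ (P ^ₛ j) (^ₛ-constant-one P j refl)) ⟩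
  one ⊛ P                           ≈⟨ ⊛-identityˡ P ⟩
  P                                 ∎
  where
  open SetoidReasoning ≈ₛ-setoid
  P : Series
  P = one ⊖ X

S^ℓ⊛[one⊖X]⊛inv≈finalForm : ∀ k ℓ →
  (S k ^ₛ ℓ ⊛ ((one ⊖ X) ⊛ inv (one ⊖ const (+ 2) ⊛ X))) ≈ₛ finalForm k ℓ
S^ℓ⊛[one⊖X]⊛inv≈finalForm k ℓ = begin
  Sℓ ⊛ (P ⊛ D⁻¹)                               ≈⟨ ⊛-congʳ Sℓ (⊛-congˡ D⁻¹ (invOneMinusXPowPred⊛[one⊖X]^ ℓ)) ⟨
  Sℓ ⊛ ((Q ⊛ P ^ₛ ℓ) ⊛ D⁻¹)                     ≈⟨ ⊛-identityʳ (Sℓ ⊛ ((Q ⊛ P ^ₛ ℓ) ⊛ D⁻¹)) ⟨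
  (Sℓ ⊛ ((Q ⊛ P ^ₛ ℓ) ⊛ D⁻¹)) ⊛ one             ≈⟨ ⊛-congʳ (Sℓ ⊛ ((Q ⊛ P ^ₛ ℓ) ⊛ D⁻¹)) (⊛-inverseʳ (B ^ₛ ℓ) (^ₛ-constant-one B ℓ refl)) ⟨
  (Sℓ ⊛ ((Q ⊛ P ^ₛ ℓ) ⊛ D⁻¹)) ⊛ (B ^ₛ ℓ ⊛ inv (B ^ₛ ℓ))
    ≈⟨ solve 6 (λ s q p d b b⁻¹ → (s ⊙ ((q ⊙ p) ⊙ d)) ⊙ (b ⊙ b⁻¹) ⊜ (((s ⊙ (p ⊙ b)) ⊙ d) ⊙ q) ⊙ b⁻¹)
               (λ _ → refl) Sℓ Q (P ^ₛ ℓ) D⁻¹ (B ^ₛ ℓ) (inv (B ^ₛ ℓ)) ⟩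
  (((Sℓ ⊛ (P ^ₛ ℓ ⊛ B ^ₛ ℓ)) ⊛ D⁻¹) ⊛ Q) ⊛ inv (B ^ₛ ℓ)
    ≈⟨ ⊛-congˡ (inv (B ^ₛ ℓ)) (⊛-congˡ Q (⊛-congˡ D⁻¹ numerator)) ⟩
  finalForm k ℓ                                ∎
  where
  open SetoidReasoning ≈ₛ-setoid
  P B D⁻¹ Q Sℓ : Series
  P = one ⊖ X
  B = one ⊕ X
  D⁻¹ = inv (one ⊖ const (+ 2) ⊛ X)
  Q = invOneMinusXPowPred ℓ
  Sℓ = S k ^ₛ ℓ
  numerator : (Sℓ ⊛ (P ^ₛ ℓ ⊛ B ^ₛ ℓ)) ≈ₛ ((X ⊛ B ⊖ X ^ₛ (k + δ k)) ^ₛ ℓ)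
  numerator = begin
    Sℓ ⊛ (P ^ₛ ℓ ⊛ B ^ₛ ℓ)            ≈⟨ ⊛-congʳ Sℓ (^ₛ-distribʳ-⊛ P B ℓ) ⟨
    Sℓ ⊛ (P ⊛ B) ^ₛ ℓ                ≈⟨ ^ₛ-distribʳ-⊛ (S k) (P ⊛ B) ℓ ⟨
    (S k ⊛ (P ⊛ B)) ^ₛ ℓ             ≈⟨ ^ₛ-cong ℓ (S⊛[one⊖X]⊛[one⊕X] k) ⟩
    (X ⊛ B ⊖ X ^ₛ (k + δ k)) ^ₛ ℓ    ∎

-- The identities hold for k = 0 as well.
proposition5p1 : (k ℓ : ℕ) → 1 ≤ k →
    (Lgf k ℓ ≈ₛ (S k ^ₛ ℓ ⊛ inv (one ⊖ U)))
    × ((S k ^ₛ ℓ ⊛ inv (one ⊖ U)) ≈ₛ (S k ^ₛ ℓ ⊛ ((one ⊖ X) ⊛ inv (one ⊖ const (+ 2) ⊛ X))))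
    × ((S k ^ₛ ℓ ⊛ ((one ⊖ X) ⊛ inv (one ⊖ const (+ 2) ⊛ X))) ≈ₛ finalForm k ℓ)
proposition5p1 k ℓ _ =
  Lgf≈S^ℓ⊛inv-one⊖U k ℓ ,
  ⊛-congʳ (S k ^ₛ ℓ) inv-one⊖U ,
  S^ℓ⊛[one⊖X]⊛inv≈finalForm k ℓ
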